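{- Let $a$ and $b$ be any positive integers and $n$ a nonnegative integer. Then the number of zero-sum words of length $(a+b)n$ in the alphabet $\{+a,-b\}$ that contain no illegal subword whose length is a multiple of $a+b$ is $\binom{a+b}{a}^n$.
   Context: A word in the alphabet $\{+a,-b\}$ is a finite sequence $w=w_1\cdots w_m$ with each $w_i\in\{+a,-b\}$; it is zero-sum if $\sum_i w_i=0$. A consecutive subword $w_i\cdots w_j$ ($1\le i\le j\le m$), of length $j-i+1$, is illegal if it is zero-sum, $w_i=+a$, and $j<m$ with $w_{j+1}=-b$. -}

module Defs where

open import Data.Nat using (ℕ; zero; suc; _+_; _*_; _<_; _≤_)
open import Data.Nat.Divisibility using (_∣_)
open import Data.Integer using (ℤ) renaming (_+_ to _+ℤ_; -_ to -ℤ_; +_ to pos)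
open import Data.List using (List; []; _∷_; length; take; drop; map; foldr)
open import Data.Product using (Σ; ∃; _×_; _,_)
open import Relation.Nullary using (¬_)
open import Relation.Binary.PropositionalEquality using (_≡_)
open import Data.Maybe using (Maybe; just)
open import Data.List using (head)

data Letter : Set where
  plusA minusB : Letter

Word : Set
Word = List Letter

val : ℕ → ℕ → Letter → ℤ
val a b plusA = pos a
val a b minusB = -ℤ (pos b)

wsum : ℕ → ℕ → Word → ℤ
wsum a b w = foldr (λ x s → val a b x +ℤ s) (pos 0) w

ZeroSum : ℕ → ℕ → Word → Set
ZeroSum a b w = wsum a b w ≡ pos 0

subword : Word → ℕ → ℕ → Word
subword w i len = take len (drop i w)

-- Illegal subword starting at 0-based position i with length len ≥ 1
-- (i.e. w_{i+1} ⋯ w_{i+len} in 1-based indexing, with j = i + len):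
-- zero-sum, first letter +a, j < m and the next letter w_{j+1} is -b.
IllegalAt : ℕ → ℕ → Word → ℕ → ℕ → Set
IllegalAt a b w i len =
  (1 ≤ len) × (i + len < length w) ×
  ZeroSum a b (subword w i len) ×
  (head (drop i w) ≡ just plusA) ×
  (head (drop (i + len) w) ≡ just minusB)

NoBadIllegal : ℕ → ℕ → Word → Set
NoBadIllegal a b w = ∀ i len → (a + b) ∣ len → ¬ IllegalAt a b w i len

Counted : ℕ → ℕ → ℕ → Word → Set
Counted a b m w = (length w ≡ m) × ZeroSum a b w × NoBadIllegal a b w

open import Data.List.Relation.Unary.All using (All)
open import Data.List.Relation.Unary.Unique.Propositional using (Unique)
open import Data.List.Membership.Propositional using (_∈_)

-- "The number of words w satisfying P is N": there is a duplicate-free list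
-- enumerating exactly the words satisfying P, and it has length N.
HasCount : (Word → Set) → ℕ → Set
HasCount P N = Σ (List Word) (λ ws →
  Unique ws × All P ws × (∀ w → P w → w ∈ ws) × (length ws ≡ N))

{-# OPTIONS --safe #-}
-- Put s = a + b and read a word as a lattice path: height w t is the sum of its first t
-- letters.  The words of length s(n+1) being counted are in bijection with pairs (w , B) of a
-- counted word w of length sn and a zero-sum block B of length s, of which there are C(s,a).
-- The word attached to (w , B) inserts into w, at the first position p minimising the gap
-- height w t − height∞ B t, the length-s window of the periodic word B B B ⋯ starting at
-- phase p; minimality of the gap is what keeps the result free of bad illegal subwords.
-- Conversely, p is recovered from the long word as its first position whose height is
-- minimal in its residue class mod s: the positions p, …, p + s are then all class minima,
-- because a +a followed in the same class and at the same height by a −b would be an illegal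
-- subword of length divisible by s.  Deleting that window gives w, and the window, rotated
-- to phase 0, gives B.
module Submission where

open import Defs
open import Data.Nat as ℕ
  using (ℕ; zero; suc; _+_; _*_; _∸_; _^_; _≤_; _<_; z≤n; s≤s; _%_; _/_; NonZero)
import Data.Nat.Properties as ℕ
open import Data.Nat.DivMod
  using (m≡m%n+[m/n]*n; [m+n]%n≡m%n; [m+kn]%n≡m%n; m%n<n; m<n⇒m%n≡m; /-monoˡ-≤; m%n%n≡m%n; m*n%n≡0)
open import Data.Nat.Divisibility using (divides)
open import Data.Nat.Combinatorics using (_C_; nCk+nC[k+1]≡[n+1]C[k+1])
open import Data.Integer as ℤ using (ℤ; +_; -[1+_])
import Data.Integer.Properties as ℤ
open import Algebra.Properties.AbelianGroup ℤ.+-0-abelianGroup using (identityʳ-unique; ∙-cancelʳ)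
open import Data.Integer.Tactic.RingSolver using (solve-∀)
open import Data.Nat.Tactic.RingSolver using () renaming (solve-∀ to ℕ-solve-∀)
open import Data.List using (List; []; _∷_; [_]; length; take; drop; _++_; head; map; cartesianProduct)
import Data.List.Properties as List
open import Data.List.Membership.Propositional using (_∈_)
open import Data.List.Membership.Propositional.Properties
  using (∈-map⁺; ∈-map⁻; ∈-++⁺ˡ; ∈-++⁺ʳ; ∈-++⁻; ∈-cartesianProduct⁺; ∈-cartesianProduct⁻)
open import Data.List.Relation.Unary.Any using (here)
open import Data.List.Relation.Unary.All as All using (All; []; _∷_)
import Data.List.Relation.Unary.All.Properties as All
open import Data.List.Relation.Unary.AllPairs using ([]; _∷_)
open import Data.List.Relation.Unary.Unique.Propositional using (Unique)
import Data.List.Relation.Unary.Unique.Propositional.Properties as Unique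
open import Data.Maybe using (Maybe; just; fromMaybe)
open import Data.Maybe.Properties using (just-injective)
open import Data.Product using (∃; _×_; _,_; proj₁; proj₂; uncurry)
open import Data.Sum using (inj₁; inj₂)
open import Data.Empty using (⊥; ⊥-elim)
open import Relation.Nullary using (¬_; Dec; yes; no)
open import Relation.Nullary.Decidable using (_×-dec_; _→-dec_; map′)
open import Relation.Binary.PropositionalEquality hiding ([_])
open import Relation.Binary.Definitions using (tri<; tri≈; tri>)

module _ {A : Set} where

  infixl 9 _!?_
  _!?_ : List A → ℕ → Maybe A
  xs !? t = head (drop t xs)

  !?-++ˡ : (xs ys : List A) {t : ℕ} → t < length xs → (xs ++ ys) !? t ≡ xs !? t
  !?-++ˡ (x ∷ xs) ys {zero}  _         = refl
  !?-++ˡ (x ∷ xs) ys {suc t} (s≤s t<n) = !?-++ˡ xs ys t<n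

  !?-++ʳ : (xs ys : List A) (t : ℕ) → (xs ++ ys) !? (length xs + t) ≡ ys !? t
  !?-++ʳ []       ys t = refl
  !?-++ʳ (x ∷ xs) ys t = !?-++ʳ xs ys t

  !?-defined : (xs : List A) {t : ℕ} → t < length xs → ∃ λ x → xs !? t ≡ just x
  !?-defined (x ∷ xs) {zero}  _         = x , refl
  !?-defined (x ∷ xs) {suc t} (s≤s t<n) = !?-defined xs t<n

  !?-ext : (xs ys : List A) → length xs ≡ length ys →
           (∀ t → t < length xs → xs !? t ≡ ys !? t) → xs ≡ ys
  !?-ext []       []       _   _  = refl
  !?-ext (x ∷ xs) (y ∷ ys) len≡ at≡ with refl ← at≡ zero (s≤s z≤n) =
    cong (x ∷_) (!?-ext xs ys (ℕ.suc-injective len≡) (λ t t<n → at≡ (suc t) (s≤s t<n)))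

  take-suc-!? : (xs : List A) (t : ℕ) {x : A} → xs !? t ≡ just x →
                take (suc t) xs ≡ take t xs ++ [ x ]
  take-suc-!? (y ∷ xs) zero    refl = refl
  take-suc-!? (y ∷ xs) (suc t) eq   = cong (y ∷_) (take-suc-!? xs t eq)

  take-++ˡ : (xs ys : List A) {t : ℕ} → t ≤ length xs → take t (xs ++ ys) ≡ take t xs
  take-++ˡ xs       ys {zero}  _         = refl
  take-++ˡ (x ∷ xs) ys {suc t} (s≤s t≤n) = cong (x ∷_) (take-++ˡ xs ys t≤n)

  take-++ʳ : (xs ys : List A) (t : ℕ) → take (length xs + t) (xs ++ ys) ≡ xs ++ take t ys
  take-++ʳ []       ys t = refl
  take-++ʳ (x ∷ xs) ys t = cong (x ∷_) (take-++ʳ xs ys t)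

  drop-length-++ : (xs ys : List A) → drop (length xs) (xs ++ ys) ≡ ys
  drop-length-++ []       ys = refl
  drop-length-++ (x ∷ xs) ys = drop-length-++ xs ys

  take-+ : (xs : List A) (t u : ℕ) → take (t + u) xs ≡ take t xs ++ take u (drop t xs)
  take-+ xs       zero    u = refl
  take-+ []       (suc t) u = sym (List.take-[] u)
  take-+ (x ∷ xs) (suc t) u = cong (x ∷_) (take-+ xs t u)

  take-length : (xs : List A) → take (length xs) xs ≡ xs
  take-length xs = List.take-all (length xs) xs ℕ.≤-refl

  take-take-≤ : (xs : List A) {t u : ℕ} → t ≤ u → take t (take u xs) ≡ take t xs
  take-take-≤ xs {t} {u} t≤u = trans (List.take-take t u xs) (cong (λ k → take k xs) (ℕ.m≤n⇒m⊓n≡m t≤u))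

  length-take-≤ : (xs : List A) {t : ℕ} → t ≤ length xs → length (take t xs) ≡ t
  length-take-≤ xs {t} t≤n = trans (List.length-take t xs) (ℕ.m≤n⇒m⊓n≡m t≤n)

  length-take-drop : (xs : List A) {t u : ℕ} → t + u ≤ length xs → length (take u (drop t xs)) ≡ u
  length-take-drop xs {t} {u} t+u≤n = length-take-≤ (drop t xs)
    (subst (u ≤_) (sym (List.length-drop t xs)) (ℕ.m+n≤o⇒m≤o∸n u (subst (_≤ length xs) (ℕ.+-comm t u) t+u≤n)))

  ++-injective : (xs ys xs′ ys′ : List A) → length xs ≡ length xs′ →
                 xs ++ ys ≡ xs′ ++ ys′ → xs ≡ xs′ × ys ≡ ys′
  ++-injective []       ys []         ys′ _    eq = refl , eq
  ++-injective (x ∷ xs) ys (x′ ∷ xs′) ys′ len≡ eq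
    with refl , eq′ ← List.∷-injective eq
    with refl , refl ← ++-injective xs ys xs′ ys′ (ℕ.suc-injective len≡) eq′ = refl , refl

  segment : (ℕ → A) → ℕ → ℕ → List A
  segment f p zero    = []
  segment f p (suc k) = f p ∷ segment f (suc p) k

  length-segment : (f : ℕ → A) (p k : ℕ) → length (segment f p k) ≡ k
  length-segment f p zero    = refl
  length-segment f p (suc k) = cong suc (length-segment f (suc p) k)

  !?-segment : (f : ℕ → A) (p : ℕ) {k t : ℕ} → t < k → segment f p k !? t ≡ just (f (p + t))
  !?-segment f p {suc k} {zero}  _         = cong (λ q → just (f q)) (sym (ℕ.+-identityʳ p))
  !?-segment f p {suc k} {suc t} (s≤s t<k) =
    trans (!?-segment f (suc p) t<k) (cong (λ q → just (f q)) (sym (ℕ.+-suc p t)))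

module _ (s : ℕ) ⦃ _ : NonZero s ⦄ where

  %≡⇒≡+* : {t u : ℕ} → t ≤ u → t % s ≡ u % s → ∃ λ k → u ≡ t + k * s
  %≡⇒≡+* {t} {u} t≤u t%≡u% = u / s ∸ t / s , (begin
    u                                    ≡⟨ m≡m%n+[m/n]*n u s ⟩
    u % s + (u / s) * s                  ≡⟨ cong₂ (λ x y → x + y * s) (sym t%≡u%) (sym (ℕ.m+[n∸m]≡n t/≤u/)) ⟩
    t % s + (t / s + (u / s ∸ t / s)) * s ≡⟨ cong (λ q → t % s + q) (ℕ.*-distribʳ-+ s (t / s) _) ⟩
    t % s + ((t / s) * s + k * s)        ≡⟨ sym (ℕ.+-assoc (t % s) _ _) ⟩
    (t % s + (t / s) * s) + k * s        ≡⟨ cong (_+ k * s) (sym (m≡m%n+[m/n]*n t s)) ⟩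
    t + k * s                            ∎)
    where
    open ≡-Reasoning
    k = u / s ∸ t / s
    t/≤u/ : t / s ≤ u / s
    t/≤u/ = /-monoˡ-≤ s t≤u

  residue-in-window : (p u : ℕ) → ∃ λ t → p ≤ t × t < p + s × t % s ≡ u % s
  residue-in-window zero    u = u % s , z≤n , m%n<n u s , m<n⇒m%n≡m (m%n<n u s)
  residue-in-window (suc p) u with residue-in-window p u
  ... | t , p≤t , t<p+s , t%≡u% with p ℕ.≟ t
  ...   | yes refl = t + s , ℕ.m<m+n t (ℕ.>-nonZero⁻¹ s) , ℕ.≤-refl , trans ([m+n]%n≡m%n t s) t%≡u%
  ...   | no p≢t   = t , ℕ.≤∧≢⇒< p≤t p≢t , ℕ.m<n⇒m<1+n t<p+s , t%≡u%

  private
    residue-unique-≤ : {p x y : ℕ} → p ≤ x → y < p + s → x ≤ y → x % s ≡ y % s → x ≡ y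
    residue-unique-≤ {p} {x} p≤x y<p+s x≤y x%≡y% with %≡⇒≡+* x≤y x%≡y%
    ... | zero  , refl = sym (ℕ.+-identityʳ x)
    ... | suc k , refl = ⊥-elim (ℕ.<⇒≱ y<p+s (ℕ.≤-trans (ℕ.+-monoˡ-≤ s p≤x)
                                  (ℕ.+-monoʳ-≤ x (ℕ.m≤m+n s (k * s)))))

  residue-unique-in-window : {p x y : ℕ} → p ≤ x → x < p + s → p ≤ y → y < p + s →
                             x % s ≡ y % s → x ≡ y
  residue-unique-in-window {x = x} {y} p≤x x<p+s p≤y y<p+s x%≡y% with ℕ.≤-total x y
  ... | inj₁ x≤y = residue-unique-≤ p≤x y<p+s x≤y x%≡y%
  ... | inj₂ y≤x = sym (residue-unique-≤ p≤y x<p+s y≤x (sym x%≡y%))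

  suc-%-cancel : {x y : ℕ} → suc x % s ≡ suc y % s → x % s ≡ y % s
  suc-%-cancel {x} {y} eq with ℕ.≤-total x y
  ... | inj₁ x≤y with k , refl ← %≡⇒≡+* (s≤s x≤y) eq = sym ([m+kn]%n≡m%n x k s)
  ... | inj₂ y≤x with k , refl ← %≡⇒≡+* (s≤s y≤x) (sym eq) = [m+kn]%n≡m%n y k s

  %≡∧<⇒+s≤ : {t u : ℕ} → t < u → t % s ≡ u % s → t + s ≤ u
  %≡∧<⇒+s≤ {t} t<u t%≡u% with %≡⇒≡+* (ℕ.<⇒≤ t<u) t%≡u%
  ... | zero  , refl = ⊥-elim (ℕ.<-irrefl (sym (ℕ.+-identityʳ t)) t<u)
  ... | suc k , refl = ℕ.+-monoʳ-≤ t (ℕ.m≤m+n s (k * s))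

module _ (f : ℕ → ℤ) where

  argmin : ℕ → ℕ
  argmin zero    = 0
  argmin (suc N) with f (suc N) ℤ.<? f (argmin N)
  ... | yes _ = suc N
  ... | no  _ = argmin N

  argmin-≤ : (N : ℕ) → argmin N ≤ N
  argmin-≤ zero    = z≤n
  argmin-≤ (suc N) with f (suc N) ℤ.<? f (argmin N)
  ... | yes _ = ℕ.≤-refl
  ... | no  _ = ℕ.m≤n⇒m≤1+n (argmin-≤ N)

  argmin-minimal : (N : ℕ) {t : ℕ} → t ≤ N → f (argmin N) ℤ.≤ f t
  argmin-minimal zero    z≤n = ℤ.≤-refl
  argmin-minimal (suc N) {t} t≤N with f (suc N) ℤ.<? f (argmin N) | t ℕ.≟ suc N
  ... | yes _      | yes refl = ℤ.≤-refl
  ... | yes new<   | no t≢N   = ℤ.≤-trans (ℤ.<⇒≤ new<) (argmin-minimal N (ℕ.≤-pred (ℕ.≤∧≢⇒< t≤N t≢N)))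
  ... | no  new≮   | yes refl = ℤ.≮⇒≥ new≮
  ... | no  _      | no t≢N   = argmin-minimal N (ℕ.≤-pred (ℕ.≤∧≢⇒< t≤N t≢N))

  argmin-first : (N : ℕ) {t : ℕ} → t < argmin N → f (argmin N) ℤ.< f t
  argmin-first (suc N) t<min with f (suc N) ℤ.<? f (argmin N)
  ... | yes new< = ℤ.<-≤-trans new< (argmin-minimal N (ℕ.≤-pred t<min))
  ... | no  _    = argmin-first N t<min

  argmin-unique : (N : ℕ) {q : ℕ} → q ≤ N → (∀ {t} → t ≤ N → f q ℤ.≤ f t) →
                  (∀ {t} → t < q → f q ℤ.< f t) → argmin N ≡ q
  argmin-unique N {q} q≤N minimal first with ℕ.<-cmp (argmin N) q
  ... | tri≈ _ eq _ = eq
  ... | tri< m<q _ _ = ⊥-elim (ℤ.<⇒≱ (first m<q) (argmin-minimal N q≤N))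
  ... | tri> _ _ q<m = ⊥-elim (ℤ.<⇒≱ (argmin-first N q<m) (minimal (argmin-≤ N)))

least-witness : {P : ℕ → Set} → (∀ t → Dec (P t)) → {n : ℕ} → P n →
                ∃ λ m → P m × (∀ {t} → t < m → ¬ P t)
least-witness {P} P? {n} Pn = search 0 (λ ()) n Pn
  where
  search : (k : ℕ) → (∀ {t} → t < k → ¬ P t) → (m : ℕ) → P (k + m) →
           ∃ λ m → P m × (∀ {t} → t < m → ¬ P t)
  search k below zero    Pk+m = k , subst P (ℕ.+-identityʳ k) Pk+m , below
  search k below (suc m) Pk+m with P? k
  ... | yes Pk = k , Pk , below
  ... | no ¬Pk = search (suc k) below′ m (subst P (ℕ.+-suc k m) Pk+m)
    where
    below′ : ∀ {t} → t < suc k → ¬ P t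
    below′ {t} t<k+1 with t ℕ.≟ k
    ... | yes refl = ¬Pk
    ... | no t≢k   = below (ℕ.≤∧≢⇒< (ℕ.≤-pred t<k+1) t≢k)

module _ (i j k : ℤ) where

  private
    +-−-cancel : ∀ x y → (x ℤ.+ y) ℤ.- y ≡ x
    +-−-cancel = solve-∀

  +-cancelʳ-≤ : i ℤ.+ k ℤ.≤ j ℤ.+ k → i ℤ.≤ j
  +-cancelʳ-≤ le = subst₂ ℤ._≤_ (+-−-cancel i k) (+-−-cancel j k) (ℤ.+-monoˡ-≤ (ℤ.- k) le)

  +-cancelʳ-< : i ℤ.+ k ℤ.< j ℤ.+ k → i ℤ.< j
  +-cancelʳ-< lt = subst₂ ℤ._<_ (+-−-cancel i k) (+-−-cancel j k) (ℤ.+-monoˡ-< (ℤ.- k) lt)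

  +-cancelˡ-≤ : k ℤ.+ i ℤ.≤ k ℤ.+ j → i ℤ.≤ j
  +-cancelˡ-≤ le = +-cancelʳ-≤ (subst₂ ℤ._≤_ (ℤ.+-comm k i) (ℤ.+-comm k j) le)

  +-cancelˡ-< : k ℤ.+ i ℤ.< k ℤ.+ j → i ℤ.< j
  +-cancelˡ-< lt = +-cancelʳ-< (subst₂ ℤ._<_ (ℤ.+-comm k i) (ℤ.+-comm k j) lt)

0≤n*z<n⇒z≡0 : (n : ℕ) .⦃ _ : NonZero n ⦄ (z : ℤ) → + 0 ℤ.≤ + n ℤ.* z → + n ℤ.* z ℤ.< + n → z ≡ + 0
0≤n*z<n⇒z≡0 n       (+ zero)  _ _    = refl
0≤n*z<n⇒z≡0 n       (+ suc m) _ nz<n =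
  ⊥-elim (ℕ.<⇒≱ (ℤ.drop‿+<+ (subst (ℤ._< + n) (sym (ℤ.pos-* n (suc m))) nz<n)) (ℕ.m≤m*n n (suc m)))
0≤n*z<n⇒z≡0 (suc n) -[1+ m ]  () _

#plus #minus : Word → ℕ
#plus []           = 0
#plus (plusA ∷ x)  = suc (#plus x)
#plus (minusB ∷ x) = #plus x
#minus []           = 0
#minus (plusA ∷ x)  = #minus x
#minus (minusB ∷ x) = suc (#minus x)

#plus+#minus : (x : Word) → #plus x + #minus x ≡ length x
#plus+#minus []           = refl
#plus+#minus (plusA ∷ x)  = cong suc (#plus+#minus x)
#plus+#minus (minusB ∷ x) = trans (ℕ.+-suc (#plus x) (#minus x)) (cong suc (#plus+#minus x))

wordsWith : ℕ → ℕ → List Word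
wordsWith zero    zero    = [ [] ]
wordsWith zero    (suc k) = []
wordsWith (suc m) zero    = map (plusA ∷_) (wordsWith m zero)
wordsWith (suc m) (suc k) = map (minusB ∷_) (wordsWith m k) ++ map (plusA ∷_) (wordsWith m (suc k))

length-wordsWith : (m k : ℕ) → length (wordsWith m k) ≡ m C k
length-wordsWith zero    zero    = refl
length-wordsWith zero    (suc k) = refl
length-wordsWith (suc m) zero    = trans (List.length-map _ (wordsWith m zero)) (length-wordsWith m zero)
length-wordsWith (suc m) (suc k) = begin
  length (map (minusB ∷_) (wordsWith m k) ++ map (plusA ∷_) (wordsWith m (suc k)))
    ≡⟨ List.length-++ (map (minusB ∷_) (wordsWith m k)) ⟩
  length (map (minusB ∷_) (wordsWith m k)) + length (map (plusA ∷_) (wordsWith m (suc k)))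
    ≡⟨ cong₂ _+_ (List.length-map _ (wordsWith m k)) (List.length-map _ (wordsWith m (suc k))) ⟩
  length (wordsWith m k) + length (wordsWith m (suc k))
    ≡⟨ cong₂ _+_ (length-wordsWith m k) (length-wordsWith m (suc k)) ⟩
  m C k + m C suc k
    ≡⟨ nCk+nC[k+1]≡[n+1]C[k+1] m k ⟩
  suc m C suc k ∎
  where open ≡-Reasoning

∈-wordsWith⁻ : (m k : ℕ) {x : Word} → x ∈ wordsWith m k → length x ≡ m × #minus x ≡ k
∈-wordsWith⁻ zero    zero    (here refl) = refl , refl
∈-wordsWith⁻ (suc m) zero    x∈ with _ , y∈ , refl ← ∈-map⁻ (plusA ∷_) x∈
                                   with len≡ , #≡ ← ∈-wordsWith⁻ m zero y∈ = cong suc len≡ , #≡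
∈-wordsWith⁻ (suc m) (suc k) x∈ with ∈-++⁻ (map (minusB ∷_) (wordsWith m k)) x∈
... | inj₁ x∈₁ with _ , y∈ , refl ← ∈-map⁻ (minusB ∷_) x∈₁
               with len≡ , #≡ ← ∈-wordsWith⁻ m k y∈ = cong suc len≡ , cong suc #≡
... | inj₂ x∈₂ with _ , y∈ , refl ← ∈-map⁻ (plusA ∷_) x∈₂
               with len≡ , #≡ ← ∈-wordsWith⁻ m (suc k) y∈ = cong suc len≡ , #≡

∈-wordsWith⁺ : (x : Word) → x ∈ wordsWith (length x) (#minus x)
∈-wordsWith⁺ []           = here refl
∈-wordsWith⁺ (plusA ∷ x) with #minus x | ∈-wordsWith⁺ x
... | zero  | x∈ = ∈-map⁺ (plusA ∷_) x∈
... | suc k | x∈ = ∈-++⁺ʳ (map (minusB ∷_) (wordsWith (length x) k)) (∈-map⁺ (plusA ∷_) x∈)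
∈-wordsWith⁺ (minusB ∷ x) = ∈-++⁺ˡ (∈-map⁺ (minusB ∷_) (∈-wordsWith⁺ x))

wordsWith-unique : (m k : ℕ) → Unique (wordsWith m k)
wordsWith-unique zero    zero    = [] ∷ []
wordsWith-unique zero    (suc k) = []
wordsWith-unique (suc m) zero    = Unique.map⁺ List.∷-injectiveʳ (wordsWith-unique m zero)
wordsWith-unique (suc m) (suc k) =
  Unique.++⁺ (Unique.map⁺ List.∷-injectiveʳ (wordsWith-unique m k))
             (Unique.map⁺ List.∷-injectiveʳ (wordsWith-unique m (suc k))) disjoint
  where
  disjoint : ∀ {x} → ¬ (x ∈ map (minusB ∷_) (wordsWith m k) × x ∈ map (plusA ∷_) (wordsWith m (suc k)))
  disjoint (x∈₁ , x∈₂)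
    with _ , _ , refl ← ∈-map⁻ (minusB ∷_) x∈₁ | _ , _ , () ← ∈-map⁻ (plusA ∷_) x∈₂

module _ {A B : Set} {P : A → Set} (f : A → B) (injective : ∀ {x y} → P x → P y → f x ≡ f y → x ≡ y) where

  map⁺-injectiveOn : {xs : List A} → All P xs → Unique xs → Unique (map f xs)
  map⁺-injectiveOn []         []             = []
  map⁺-injectiveOn (px ∷ pxs) (x∉xs ∷ uxs) =
    All.map⁺ (All.zipWith (λ (x≢y , py) fx≡fy → x≢y (injective px py fx≡fy)) (x∉xs , pxs)) ∷
    map⁺-injectiveOn pxs uxs

length-cartesianProduct : {A B : Set} (xs : List A) (ys : List B) →
                          length (cartesianProduct xs ys) ≡ length xs * length ys
length-cartesianProduct []       ys = refl
length-cartesianProduct (x ∷ xs) ys = trans (List.length-++ (map (x ,_) ys))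
  (cong₂ _+_ (List.length-map (x ,_) ys) (length-cartesianProduct xs ys))

hasCount-image : {P Q R : Word → Set} {M K : ℕ} → HasCount P M → HasCount Q K →
                 (f : Word → Word → Word) → (∀ {w B} → P w → Q B → R (f w B)) →
                 (∀ {w w′ B B′} → P w → Q B → P w′ → Q B′ → f w B ≡ f w′ B′ → w ≡ w′ × B ≡ B′) →
                 (∀ {W} → R W → ∃ λ w → ∃ λ B → P w × Q B × f w B ≡ W) →
                 HasCount R (M * K)
hasCount-image {P} {Q} {R} {M} {K} (ws , ws-unique , ws-P , ws-complete , |ws|)
                           (Bs , Bs-unique , Bs-Q , Bs-complete , |Bs|) f f-R f-injective f-onto =
  map (uncurry f) pairs ,
  map⁺-injectiveOn (uncurry f) (λ (Pw , QB) (Pw′ , QB′) eq → ×-≡ (f-injective Pw QB Pw′ QB′ eq))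
                   pairs-valid (Unique.cartesianProduct⁺ ws-unique Bs-unique) ,
  All.map⁺ (All.map (λ (Pw , QB) → f-R Pw QB) pairs-valid) ,
  complete ,
  trans (List.length-map _ pairs) (trans (length-cartesianProduct ws Bs) (cong₂ _*_ |ws| |Bs|))
  where
  pairs = cartesianProduct ws Bs
  pairs-valid : All (λ (w , B) → P w × Q B) pairs
  pairs-valid = All.tabulate λ {(w , B)} wB∈ → let w∈ , B∈ = ∈-cartesianProduct⁻ ws Bs wB∈ in
    All.lookup ws-P w∈ , All.lookup Bs-Q B∈
  ×-≡ : {w w′ B B′ : Word} → w ≡ w′ × B ≡ B′ → (w , B) ≡ (w′ , B′)
  ×-≡ (refl , refl) = refl
  complete : ∀ W → R W → W ∈ map (uncurry f) pairs
  complete W RW with w , B , Pw , QB , refl ← f-onto RW =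
    ∈-map⁺ (uncurry f) (∈-cartesianProduct⁺ (ws-complete w Pw) (Bs-complete B QB))


module ZeroSumWords (a b : ℕ) ⦃ _ : NonZero (a + b) ⦄ where

  s : ℕ
  s = a + b

  value : Letter → ℤ
  value = val a b

  sum : Word → ℤ
  sum = wsum a b

  height : Word → ℕ → ℤ
  height w t = sum (take t w)

  sum-++ : (xs ys : Word) → sum (xs ++ ys) ≡ sum xs ℤ.+ sum ys
  sum-++ []       ys = sym (ℤ.+-identityˡ (sum ys))
  sum-++ (x ∷ xs) ys =
    trans (cong (λ r → value x ℤ.+ r) (sum-++ xs ys)) (sym (ℤ.+-assoc (value x) (sum xs) (sum ys)))

  height-+ : (w : Word) (t u : ℕ) → height w (t + u) ≡ height w t ℤ.+ sum (take u (drop t w))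
  height-+ w t u = trans (cong sum (take-+ w t u)) (sum-++ (take t w) _)

  height-suc : (w : Word) (t : ℕ) {x : Letter} → w !? t ≡ just x →
               height w (suc t) ≡ height w t ℤ.+ value x
  height-suc w t {x} eq = begin
    sum (take (suc t) w)             ≡⟨ cong sum (take-suc-!? w t eq) ⟩
    sum (take t w ++ [ x ])          ≡⟨ sum-++ (take t w) [ x ] ⟩
    height w t ℤ.+ (value x ℤ.+ + 0) ≡⟨ cong (λ r → height w t ℤ.+ r) (ℤ.+-identityʳ (value x)) ⟩
    height w t ℤ.+ value x           ∎
    where open ≡-Reasoning

  height-length : (w : Word) → height w (length w) ≡ sum w
  height-length w = cong sum (take-length w)

  sum-#plus-#minus : (x : Word) → sum x ≡ + a ℤ.* + #plus x ℤ.- + b ℤ.* + #minus x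
  sum-#plus-#minus [] = empty (+ a) (+ b)
    where
    empty : ∀ A B → + 0 ≡ A ℤ.* + 0 ℤ.- B ℤ.* + 0
    empty = solve-∀
  sum-#plus-#minus (plusA ∷ x) = begin
    + a ℤ.+ sum x                                      ≡⟨ cong (λ r → + a ℤ.+ r) (sum-#plus-#minus x) ⟩
    + a ℤ.+ (+ a ℤ.* P ℤ.- + b ℤ.* M)                  ≡⟨ step (+ a) P (+ b) M ⟩
    + a ℤ.* (+ 1 ℤ.+ P) ℤ.- + b ℤ.* M                  ∎
    where
    open ≡-Reasoning
    P = + #plus x
    M = + #minus x
    step : ∀ A P B M → A ℤ.+ (A ℤ.* P ℤ.- B ℤ.* M) ≡ A ℤ.* (+ 1 ℤ.+ P) ℤ.- B ℤ.* M
    step = solve-∀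
  sum-#plus-#minus (minusB ∷ x) = begin
    ℤ.- + b ℤ.+ sum x                                  ≡⟨ cong (λ r → ℤ.- + b ℤ.+ r) (sum-#plus-#minus x) ⟩
    ℤ.- + b ℤ.+ (+ a ℤ.* P ℤ.- + b ℤ.* M)              ≡⟨ step (+ a) P (+ b) M ⟩
    + a ℤ.* P ℤ.- + b ℤ.* (+ 1 ℤ.+ M)                  ∎
    where
    open ≡-Reasoning
    P = + #plus x
    M = + #minus x
    step : ∀ A P B M → ℤ.- B ℤ.+ (A ℤ.* P ℤ.- B ℤ.* M) ≡ A ℤ.* P ℤ.- B ℤ.* (+ 1 ℤ.+ M)
    step = solve-∀

  sum-multiple-of-s : (x : Word) (k : ℕ) → length x ≡ k * s → ∃ λ z → sum x ≡ + s ℤ.* z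
  sum-multiple-of-s x k len≡ = P ℤ.- + b ℤ.* + k , (begin
    sum x                                          ≡⟨ sum-#plus-#minus x ⟩
    + a ℤ.* P ℤ.- + b ℤ.* M                        ≡⟨ regroup (+ a) (+ b) P M ⟩
    + s ℤ.* P ℤ.- + b ℤ.* (P ℤ.+ M)                ≡⟨ cong (λ r → + s ℤ.* P ℤ.- + b ℤ.* r) P+M≡k*s ⟩
    + s ℤ.* P ℤ.- + b ℤ.* (+ k ℤ.* + s)            ≡⟨ factor (+ s) P (+ b) (+ k) ⟩
    + s ℤ.* (P ℤ.- + b ℤ.* + k)                    ∎)
    where
    open ≡-Reasoning
    P = + #plus x
    M = + #minus x
    P+M≡k*s : P ℤ.+ M ≡ + k ℤ.* + s
    P+M≡k*s = trans (cong +_ (trans (#plus+#minus x) len≡)) (ℤ.pos-* k s)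
    regroup : ∀ A B P M → A ℤ.* P ℤ.- B ℤ.* M ≡ (A ℤ.+ B) ℤ.* P ℤ.- B ℤ.* (P ℤ.+ M)
    regroup = solve-∀
    factor : ∀ S P B K → S ℤ.* P ℤ.- B ℤ.* (K ℤ.* S) ≡ S ℤ.* (P ℤ.- B ℤ.* K)
    factor = solve-∀

  height-≡-mod-s : (w : Word) {t u : ℕ} → t % s ≡ u % s → t ≤ length w → u ≤ length w →
                   ∃ λ z → height w u ≡ height w t ℤ.+ + s ℤ.* z
  height-≡-mod-s w {t} {u} t%≡u% t≤n u≤n with ℕ.≤-total t u
  ... | inj₁ t≤u with k , refl ← %≡⇒≡+* s t≤u t%≡u% =
    let z , sum≡ = sum-multiple-of-s (take (k * s) (drop t w)) k (length-take-drop w u≤n)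
    in z , trans (height-+ w t (k * s)) (cong (λ r → height w t ℤ.+ r) sum≡)
  ... | inj₂ u≤t with k , refl ← %≡⇒≡+* s u≤t (sym t%≡u%) =
    let z , sum≡ = sum-multiple-of-s (take (k * s) (drop u w)) k (length-take-drop w t≤n)
    in ℤ.- z , (begin
      height w u
        ≡⟨ shift (height w u) (+ s) z ⟩
      (height w u ℤ.+ + s ℤ.* z) ℤ.+ + s ℤ.* ℤ.- z
        ≡⟨ cong (λ r → (height w u ℤ.+ r) ℤ.+ + s ℤ.* ℤ.- z) (sym sum≡) ⟩
      height w u ℤ.+ sum (take (k * s) (drop u w)) ℤ.+ + s ℤ.* ℤ.- z
        ≡⟨ cong (λ r → r ℤ.+ + s ℤ.* ℤ.- z) (sym (height-+ w u (k * s))) ⟩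
      height w (u + k * s) ℤ.+ + s ℤ.* ℤ.- z ∎)
    where
    open ≡-Reasoning
    shift : ∀ h S z → h ≡ (h ℤ.+ S ℤ.* z) ℤ.+ S ℤ.* ℤ.- z
    shift = solve-∀

  height-rigid-mod-s : (w : Word) {t u : ℕ} → t % s ≡ u % s → t ≤ length w → u ≤ length w →
                       height w t ℤ.≤ height w u → height w u ℤ.< height w t ℤ.+ + s →
                       height w u ≡ height w t
  height-rigid-mod-s w {t} {u} t%≡u% t≤n u≤n lower upper
    with z , u≡t+sz ← height-≡-mod-s w t%≡u% t≤n u≤n
    with refl ← 0≤n*z<n⇒z≡0 s z
      (+-cancelˡ-≤ (+ 0) (+ s ℤ.* z) (height w t) (subst₂ ℤ._≤_ (sym (ℤ.+-identityʳ _)) u≡t+sz lower))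
      (+-cancelˡ-< (+ s ℤ.* z) (+ s) (height w t) (subst (ℤ._< height w t ℤ.+ + s) u≡t+sz upper)) =
    trans u≡t+sz (trans (cong (λ r → height w t ℤ.+ r) (ℤ.*-zeroʳ (+ s))) (ℤ.+-identityʳ _))

  IsBlock : Word → Set
  IsBlock B = length B ≡ s × sum B ≡ + 0

  -- The default plusA is junk: letterAt is only used below the length of the word.
  letterAt : Word → ℕ → Letter
  letterAt w t = fromMaybe plusA (w !? t)

  letterAt-< : (w : Word) {t : ℕ} → t < length w → w !? t ≡ just (letterAt w t)
  letterAt-< w t<n with x , w!?t ← !?-defined w t<n rewrite w!?t = refl

  -- letter∞ B and height∞ B describe the infinite periodic word B B B ⋯.
  letter∞ : Word → ℕ → Letter
  letter∞ B t = letterAt B (t % s)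

  height∞ : Word → ℕ → ℤ
  height∞ B zero    = + 0
  height∞ B (suc t) = height∞ B t ℤ.+ value (letter∞ B t)

  letter∞-mod-s : (B : Word) {t u : ℕ} → t % s ≡ u % s → letter∞ B t ≡ letter∞ B u
  letter∞-mod-s B t%≡u% = cong (letterAt B) t%≡u%

  letter∞-< : (B : Word) → length B ≡ s → {t : ℕ} → t < s → B !? t ≡ just (letter∞ B t)
  letter∞-< B len≡ {t} t<s rewrite m<n⇒m%n≡m t<s = letterAt-< B (subst (t <_) (sym len≡) t<s)

  height∞-+s : (B : Word) (t : ℕ) → height∞ B (t + s) ≡ height∞ B t ℤ.+ height∞ B s
  height∞-+s B zero    = sym (ℤ.+-identityˡ (height∞ B s))
  height∞-+s B (suc t) = begin
    height∞ B (t + s) ℤ.+ value (letter∞ B (t + s))        ≡⟨ cong₂ ℤ._+_ (height∞-+s B t)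
                                                                 (cong value (letter∞-mod-s B ([m+n]%n≡m%n t s))) ⟩
    (height∞ B t ℤ.+ height∞ B s) ℤ.+ value (letter∞ B t)  ≡⟨ swap (height∞ B t) _ _ ⟩
    (height∞ B t ℤ.+ value (letter∞ B t)) ℤ.+ height∞ B s  ∎
    where
    open ≡-Reasoning
    swap : ∀ x y z → (x ℤ.+ y) ℤ.+ z ≡ (x ℤ.+ z) ℤ.+ y
    swap = solve-∀

  height∞-≤s : (B : Word) → length B ≡ s → {j : ℕ} → j ≤ s → height∞ B j ≡ height B j
  height∞-≤s B len≡ {zero}  _   = refl
  height∞-≤s B len≡ {suc j} j<s = begin
    height∞ B j ℤ.+ value (letter∞ B j)
      ≡⟨ cong (λ r → r ℤ.+ value (letter∞ B j)) (height∞-≤s B len≡ (ℕ.<⇒≤ j<s)) ⟩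
    height B j ℤ.+ value (letter∞ B j)
      ≡⟨ sym (height-suc B j (letter∞-< B len≡ j<s)) ⟩
    height B (suc j) ∎
    where open ≡-Reasoning

  height-segment : (B : Word) (p : ℕ) {k j : ℕ} → j ≤ k →
                   height (segment (letter∞ B) p k) j ≡ height∞ B (p + j) ℤ.- height∞ B p
  height-segment B p {k}     {zero}  _ rewrite ℕ.+-identityʳ p = sym (ℤ.+-inverseʳ (height∞ B p))
  height-segment B p {suc k} {suc j} (s≤s j≤k) = begin
    x ℤ.+ height (segment (letter∞ B) (suc p) k) j
      ≡⟨ cong (λ r → x ℤ.+ r) (height-segment B (suc p) j≤k) ⟩
    x ℤ.+ (height∞ B (suc p + j) ℤ.- (height∞ B p ℤ.+ x))
      ≡⟨ cancel x (height∞ B (suc p + j)) (height∞ B p) ⟩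
    height∞ B (suc p + j) ℤ.- height∞ B p
      ≡⟨ cong (λ r → height∞ B r ℤ.- height∞ B p) (sym (ℕ.+-suc p j)) ⟩
    height∞ B (p + suc j) ℤ.- height∞ B p ∎
    where
    open ≡-Reasoning
    x = value (letter∞ B p)
    cancel : ∀ x X h → x ℤ.+ (X ℤ.- (h ℤ.+ x)) ≡ X ℤ.- h
    cancel = solve-∀

  module _ {B : Word} (blk : IsBlock B) where

    height∞-s : height∞ B s ≡ + 0
    height∞-s = trans (height∞-≤s B (proj₁ blk) ℕ.≤-refl)
                      (trans (cong (height B) (sym (proj₁ blk))) (trans (height-length B) (proj₂ blk)))

    height∞-periodic : (t : ℕ) → height∞ B (t + s) ≡ height∞ B t
    height∞-periodic t = trans (height∞-+s B t)
      (trans (cong (λ r → height∞ B t ℤ.+ r) height∞-s) (ℤ.+-identityʳ (height∞ B t)))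

    height∞-+*s : (t k : ℕ) → height∞ B (t + k * s) ≡ height∞ B t
    height∞-+*s t zero    = cong (height∞ B) (ℕ.+-identityʳ t)
    height∞-+*s t (suc k) = begin
      height∞ B (t + (s + k * s)) ≡⟨ cong (height∞ B) (shuffle t s (k * s)) ⟩
      height∞ B ((t + k * s) + s) ≡⟨ height∞-periodic (t + k * s) ⟩
      height∞ B (t + k * s)       ≡⟨ height∞-+*s t k ⟩
      height∞ B t                 ∎
      where
      open ≡-Reasoning
      shuffle : ∀ t s r → t + (s + r) ≡ (t + r) + s
      shuffle = ℕ-solve-∀

    height∞-mod-s : {t u : ℕ} → t % s ≡ u % s → height∞ B t ≡ height∞ B u
    height∞-mod-s {t} {u} t%≡u% with ℕ.≤-total t u
    ... | inj₁ t≤u with k , refl ← %≡⇒≡+* s t≤u t%≡u%       = sym (height∞-+*s t k)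
    ... | inj₂ u≤t with k , refl ← %≡⇒≡+* s u≤t (sym t%≡u%) = height∞-+*s u k

    sum-segment : (p : ℕ) → sum (segment (letter∞ B) p s) ≡ + 0
    sum-segment p = begin
      sum (segment (letter∞ B) p s)              ≡⟨ sym (height-length (segment (letter∞ B) p s)) ⟩
      height (segment (letter∞ B) p s) (length (segment (letter∞ B) p s))
                                                 ≡⟨ cong (height (segment (letter∞ B) p s)) (length-segment _ p s) ⟩
      height (segment (letter∞ B) p s) s         ≡⟨ height-segment B p ℕ.≤-refl ⟩
      height∞ B (p + s) ℤ.- height∞ B p          ≡⟨ cong (ℤ._- height∞ B p) (height∞-periodic p) ⟩
      height∞ B p ℤ.- height∞ B p                ≡⟨ ℤ.+-inverseʳ (height∞ B p) ⟩
      + 0                                        ∎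
      where open ≡-Reasoning

  -- Positions are 0-based: the illegal subword occupies positions i, …, j − 1 and is followed by
  -- the −b at position j; being zero-sum means height W i ≡ height W j.
  IllegalPair : Word → ℕ → ℕ → Set
  IllegalPair W i j = i < j × j < length W × i % s ≡ j % s × height W i ≡ height W j ×
                      W !? i ≡ just plusA × W !? j ≡ just minusB

  Admissible : Word → Set
  Admissible W = ∀ {i j} → ¬ IllegalPair W i j

  noBadIllegal⇒admissible : (W : Word) → NoBadIllegal a b W → Admissible W
  noBadIllegal⇒admissible W noBad {i} (i<j , j<n , i%≡j% , hi≡hj , W!?i , W!?j)
    with k , refl ← %≡⇒≡+* s (ℕ.<⇒≤ i<j) i%≡j% =
    noBad i (k * s) (divides k refl) (1≤k*s , j<n , zeroSum , W!?i , W!?j)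
    where
    1≤k*s : 1 ≤ k * s
    1≤k*s = ℕ.+-cancelˡ-≤ i 1 (k * s) (subst (_≤ i + k * s) (ℕ.+-comm 1 i) i<j)
    zeroSum : sum (take (k * s) (drop i W)) ≡ + 0
    zeroSum = identityʳ-unique (height W i) _ (sym (trans hi≡hj (height-+ W i (k * s))))

  admissible⇒noBadIllegal : (W : Word) → Admissible W → NoBadIllegal a b W
  admissible⇒noBadIllegal W adm i L (divides q refl) (1≤L , j<n , zeroSum , W!?i , W!?j) =
    adm (ℕ.m<m+n i 1≤L , j<n , sym ([m+kn]%n≡m%n i q s) , hi≡hj , W!?i , W!?j)
    where
    hi≡hj : height W i ≡ height W (i + q * s)
    hi≡hj = sym (begin
      height W (i + q * s)                        ≡⟨ height-+ W i (q * s) ⟩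
      height W i ℤ.+ sum (take (q * s) (drop i W)) ≡⟨ cong (λ r → height W i ℤ.+ r) zeroSum ⟩
      height W i ℤ.+ + 0                          ≡⟨ ℤ.+-identityʳ _ ⟩
      height W i                                  ∎)
      where open ≡-Reasoning

  private module SpliceOf (X Y Z : Word) {p : ℕ} (lenX : length X ≡ p) (lenY : length Y ≡ s) where

    long short : Word
    long  = X ++ Y ++ Z
    short = X ++ Z

    length-long : length long ≡ length short + s
    length-long = begin
      length (X ++ Y ++ Z)           ≡⟨ List.length-++ X ⟩
      length X + length (Y ++ Z)     ≡⟨ cong (λ r → length X + r) (List.length-++ Y) ⟩
      length X + (length Y + length Z) ≡⟨ cong (λ r → length X + (r + length Z)) lenY ⟩
      length X + (s + length Z)      ≡⟨ shuffle (length X) s (length Z) ⟩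
      (length X + length Z) + s      ≡⟨ cong (_+ s) (sym (List.length-++ X)) ⟩
      length (X ++ Z) + s            ∎
      where
      open ≡-Reasoning
      shuffle : ∀ x s z → x + (s + z) ≡ (x + z) + s
      shuffle = ℕ-solve-∀

    shift : {t : ℕ} → p ≤ t → ∃ λ k → t ≡ length X + k × t + s ≡ length X + (length Y + k)
    shift {t} p≤t with k , refl ← ℕ.m≤n⇒∃[o]m+o≡n p≤t rewrite lenX | lenY =
      k , refl , trans (ℕ.+-assoc p k s) (cong (λ r → p + r) (ℕ.+-comm k s))

    !?-pre : {t : ℕ} → t < p → long !? t ≡ short !? t
    !?-pre t<p = let t<X = subst (_ <_) (sym lenX) t<p in
      trans (!?-++ˡ X (Y ++ Z) t<X) (sym (!?-++ˡ X Z t<X))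

    height-pre : {t : ℕ} → t ≤ p → height long t ≡ height short t
    height-pre t≤p = let t≤X = subst (_ ≤_) (sym lenX) t≤p in
      cong sum (trans (take-++ˡ X (Y ++ Z) t≤X) (sym (take-++ˡ X Z t≤X)))

    !?-mid : {k : ℕ} → k < s → long !? (p + k) ≡ Y !? k
    !?-mid {k} k<s rewrite sym lenX =
      trans (!?-++ʳ X (Y ++ Z) k) (!?-++ˡ Y Z (subst (k <_) (sym lenY) k<s))

    height-mid : {k : ℕ} → k ≤ s → height long (p + k) ≡ height short p ℤ.+ height Y k
    height-mid {k} k≤s rewrite sym lenX = begin
      sum (take (length X + k) (X ++ Y ++ Z))
        ≡⟨ cong sum (take-++ʳ X (Y ++ Z) k) ⟩
      sum (X ++ take k (Y ++ Z))
        ≡⟨ cong (λ r → sum (X ++ r)) (take-++ˡ Y Z (subst (k ≤_) (sym lenY) k≤s)) ⟩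
      sum (X ++ take k Y)
        ≡⟨ sum-++ X (take k Y) ⟩
      sum X ℤ.+ height Y k
        ≡⟨ cong (λ r → sum r ℤ.+ height Y k) (sym (take-++ʳ′)) ⟩
      sum (take (length X) (X ++ Z)) ℤ.+ height Y k ∎
      where
      open ≡-Reasoning
      take-++ʳ′ : take (length X) (X ++ Z) ≡ X
      take-++ʳ′ = trans (take-++ˡ X Z ℕ.≤-refl) (take-length X)

    !?-post : {t : ℕ} → p ≤ t → long !? (t + s) ≡ short !? t
    !?-post p≤t with k , refl , t+s≡ ← shift p≤t = begin
      long !? (length X + k + s)                   ≡⟨ cong (long !?_) t+s≡ ⟩
      (X ++ Y ++ Z) !? (length X + (length Y + k)) ≡⟨ !?-++ʳ X (Y ++ Z) (length Y + k) ⟩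
      (Y ++ Z) !? (length Y + k)                   ≡⟨ !?-++ʳ Y Z k ⟩
      Z !? k                                       ≡⟨ sym (!?-++ʳ X Z k) ⟩
      (X ++ Z) !? (length X + k)                   ∎
      where open ≡-Reasoning

    height-post : sum Y ≡ + 0 → {t : ℕ} → p ≤ t → height long (t + s) ≡ height short t
    height-post sumY≡0 p≤t with k , refl , t+s≡ ← shift p≤t = begin
      height long (length X + k + s)
        ≡⟨ cong (height long) t+s≡ ⟩
      sum (take (length X + (length Y + k)) (X ++ Y ++ Z))
        ≡⟨ cong sum (take-++ʳ X (Y ++ Z) _) ⟩
      sum (X ++ take (length Y + k) (Y ++ Z))
        ≡⟨ cong (λ r → sum (X ++ r)) (take-++ʳ Y Z k) ⟩
      sum (X ++ Y ++ take k Z)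
        ≡⟨ sum-++ X (Y ++ take k Z) ⟩
      sum X ℤ.+ sum (Y ++ take k Z)
        ≡⟨ cong (λ r → sum X ℤ.+ r) (sum-++ Y (take k Z)) ⟩
      sum X ℤ.+ (sum Y ℤ.+ sum (take k Z))
        ≡⟨ cong (λ r → sum X ℤ.+ (r ℤ.+ sum (take k Z))) sumY≡0 ⟩
      sum X ℤ.+ (+ 0 ℤ.+ sum (take k Z))
        ≡⟨ cong (λ r → sum X ℤ.+ r) (ℤ.+-identityˡ _) ⟩
      sum X ℤ.+ sum (take k Z)
        ≡⟨ sym (sum-++ X (take k Z)) ⟩
      sum (X ++ take k Z)
        ≡⟨ cong sum (sym (take-++ʳ X Z k)) ⟩
      height short (length X + k) ∎
      where open ≡-Reasoning

  module Splice (X Y Z : Word) {p : ℕ} (lenX : length X ≡ p) (lenY : length Y ≡ s)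
                {long short : Word} (long≡ : X ++ Y ++ Z ≡ long) (short≡ : X ++ Z ≡ short) where

    private
      module S = SpliceOf X Y Z lenX lenY
      transport : {P : Word → Word → Set} → P S.long S.short → P long short
      transport {P} = subst₂ P long≡ short≡

    length-long : length long ≡ length short + s
    length-long = transport {λ L S → length L ≡ length S + s} S.length-long

    !?-pre : {t : ℕ} → t < p → long !? t ≡ short !? t
    !?-pre {t} t<p = transport {λ L S → L !? t ≡ S !? t} (S.!?-pre t<p)

    height-pre : {t : ℕ} → t ≤ p → height long t ≡ height short t
    height-pre {t} t≤p = transport {λ L S → height L t ≡ height S t} (S.height-pre t≤p)

    !?-mid : {k : ℕ} → k < s → long !? (p + k) ≡ Y !? k
    !?-mid {k} k<s = transport {λ L _ → L !? (p + k) ≡ Y !? k} (S.!?-mid k<s)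

    height-mid : {k : ℕ} → k ≤ s → height long (p + k) ≡ height short p ℤ.+ height Y k
    height-mid {k} k≤s = transport {λ L S → height L (p + k) ≡ height S p ℤ.+ height Y k} (S.height-mid k≤s)

    !?-post : {t : ℕ} → p ≤ t → long !? (t + s) ≡ short !? t
    !?-post {t} p≤t = transport {λ L S → L !? (t + s) ≡ S !? t} (S.!?-post p≤t)

    height-post : sum Y ≡ + 0 → {t : ℕ} → p ≤ t → height long (t + s) ≡ height short t
    height-post sumY≡0 {t} p≤t = transport {λ L S → height L (t + s) ≡ height S t} (S.height-post sumY≡0 p≤t)

    +s<length-long : {t : ℕ} → t < length short → t + s < length long
    +s<length-long t<n = subst (_ <_) (sym length-long) (ℕ.+-monoˡ-< s t<n)

    admissible-short : sum Y ≡ + 0 → Admissible long → Admissible short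
    admissible-short sumY≡0 adm {i} {j} (i<j , j<n , i%≡j% , hi≡hj , short!?i , short!?j)
      with j ℕ.<? p | i ℕ.<? p
    ... | yes j<p | _ =
      adm (i<j , ℕ.<-trans (ℕ.m<m+n j (ℕ.>-nonZero⁻¹ s)) (+s<length-long j<n) , i%≡j% ,
           trans (height-pre (ℕ.<⇒≤ (ℕ.<-trans i<j j<p))) (trans hi≡hj (sym (height-pre (ℕ.<⇒≤ j<p)))) ,
           trans (!?-pre (ℕ.<-trans i<j j<p)) short!?i , trans (!?-pre j<p) short!?j)
    ... | no j≮p | yes i<p =
      adm (ℕ.<-≤-trans i<j (ℕ.m≤m+n j s) , +s<length-long j<n , trans i%≡j% (sym ([m+n]%n≡m%n j s)) ,
           trans (height-pre (ℕ.<⇒≤ i<p)) (trans hi≡hj (sym (height-post sumY≡0 (ℕ.≮⇒≥ j≮p)))) ,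
           trans (!?-pre i<p) short!?i , trans (!?-post (ℕ.≮⇒≥ j≮p)) short!?j)
    ... | no j≮p | no i≮p =
      adm (ℕ.+-monoˡ-< s i<j , +s<length-long j<n ,
           trans ([m+n]%n≡m%n i s) (trans i%≡j% (sym ([m+n]%n≡m%n j s))) ,
           trans (height-post sumY≡0 (ℕ.≮⇒≥ i≮p)) (trans hi≡hj (sym (height-post sumY≡0 (ℕ.≮⇒≥ j≮p)))) ,
           trans (!?-post (ℕ.≮⇒≥ i≮p)) short!?i , trans (!?-post (ℕ.≮⇒≥ j≮p)) short!?j)

  ClassMin : Word → ℕ → Set
  ClassMin W t = t ≤ length W × (∀ {u} → u ≤ length W → u % s ≡ t % s → height W t ℤ.≤ height W u)

  classMin? : (W : Word) (t : ℕ) → Dec (ClassMin W t)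
  classMin? W t = t ℕ.≤? length W ×-dec
    map′ (λ below {u} u≤n → below (s≤s u≤n)) (λ below {u} u<n+1 → below (ℕ.≤-pred u<n+1))
      (ℕ.allUpTo? (λ u → (u % s ℕ.≟ t % s) →-dec (height W t ℤ.≤? height W u)) (suc (length W)))

  classMin-transfer : {W : Word} {t u : ℕ} → ClassMin W t → u ≤ length W → u % s ≡ t % s →
                      height W u ≡ height W t → ClassMin W u
  classMin-transfer (_ , minimal) u≤n u%≡t% hu≡ht =
    u≤n , λ u′≤n u′%≡ → subst (ℤ._≤ _) (sym hu≡ht) (minimal u′≤n (trans u′%≡ u%≡t%))

  first-classMin : (W : Word) → ∃ λ p → ClassMin W p × (∀ {t} → t < p → ¬ ClassMin W t)
  first-classMin W = least-witness (classMin? W) {argmin (height W) (length W)}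
    (argmin-≤ (height W) (length W) , λ u≤n _ → argmin-minimal (height W) (length W) u≤n)

  gap : Word → Word → ℕ → ℤ
  gap w B t = height w t ℤ.- height∞ B t

  gap-cong : {W B : Word} → IsBlock B → {i j : ℕ} → i % s ≡ j % s → height W i ≡ height W j →
             gap W B i ≡ gap W B j
  gap-cong blk i%≡j% hi≡hj = cong₂ ℤ._-_ hi≡hj (height∞-mod-s blk i%≡j%)

  gap-suc : (W B : Word) (t : ℕ) {x : Letter} → W !? t ≡ just x →
            gap W B (suc t) ≡ gap W B t ℤ.+ (value x ℤ.- value (letter∞ B t))
  gap-suc W B t {x} W!?t = trans (cong (ℤ._- height∞ B (suc t)) (height-suc W t W!?t))
                                 (regroup (height W t) (value x) (height∞ B t) (value (letter∞ B t)))
    where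
    regroup : ∀ h x h∞ y → (h ℤ.+ x) ℤ.- (h∞ ℤ.+ y) ≡ (h ℤ.- h∞) ℤ.+ (x ℤ.- y)
    regroup = solve-∀

  minus-plus<0 : value minusB ℤ.- value plusA ℤ.< + 0
  minus-plus<0 = subst (ℤ._< + 0) (sym (neg-sum (+ a) (+ b))) (ℤ.neg-mono-< (ℤ.+<+ (ℕ.>-nonZero⁻¹ s)))
    where
    neg-sum : ∀ A B → ℤ.- B ℤ.- A ≡ ℤ.- (A ℤ.+ B)
    neg-sum = solve-∀

  gap-along-segment : {W B : Word} {p k : ℕ} {h : ℤ} → k ≤ s →
                      height W (p + k) ≡ h ℤ.+ height (segment (letter∞ B) p s) k →
                      gap W B (p + k) ≡ h ℤ.- height∞ B p
  gap-along-segment {W} {B} {p} {k} {h} k≤s height≡ = begin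
    height W (p + k) ℤ.- height∞ B (p + k)
      ≡⟨ cong (ℤ._- height∞ B (p + k)) height≡ ⟩
    h ℤ.+ height (segment (letter∞ B) p s) k ℤ.- height∞ B (p + k)
      ≡⟨ cong (λ r → h ℤ.+ r ℤ.- height∞ B (p + k)) (height-segment B p k≤s) ⟩
    h ℤ.+ (height∞ B (p + k) ℤ.- height∞ B p) ℤ.- height∞ B (p + k)
      ≡⟨ cancel h (height∞ B (p + k)) (height∞ B p) ⟩
    h ℤ.- height∞ B p ∎
    where
    open ≡-Reasoning
    cancel : ∀ x y z → x ℤ.+ (y ℤ.- z) ℤ.- y ≡ x ℤ.- z
    cancel = solve-∀

  insertionPoint : Word → Word → ℕ
  insertionPoint w B = argmin (gap w B) (length w)

  insert : Word → Word → Word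
  insert w B = take p w ++ segment (letter∞ B) p s ++ drop p w
    where p = insertionPoint w B

  module Insertion (w B : Word) (blk : IsBlock B) where

    p : ℕ
    p = insertionPoint w B

    p≤n : p ≤ length w
    p≤n = argmin-≤ (gap w B) (length w)

    open Splice (take p w) (segment (letter∞ B) p s) (drop p w) (length-take-≤ w p≤n)
                (length-segment (letter∞ B) p s) {insert w B} {w} refl (List.take++drop≡id p w) public

    v : ℤ
    v = gap w B p

    beyond : {t : ℕ} → p + s ≤ t → ∃ λ t′ → p ≤ t′ × t ≡ t′ + s
    beyond {t} p+s≤t = t ∸ s , ℕ.m+n≤o⇒m≤o∸n p p+s≤t ,
                       sym (ℕ.m∸n+n≡m (ℕ.≤-trans (ℕ.m≤n+m s p) p+s≤t))

    gap-pre : {t : ℕ} → t ≤ p → gap (insert w B) B t ≡ gap w B t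
    gap-pre {t} t≤p = cong (ℤ._- height∞ B t) (height-pre t≤p)

    gap-mid : {k : ℕ} → k ≤ s → gap (insert w B) B (p + k) ≡ v
    gap-mid {k} k≤s = gap-along-segment {insert w B} {B} {p} {k} {height w p} k≤s (height-mid k≤s)

    gap-post : {t : ℕ} → p ≤ t → gap (insert w B) B (t + s) ≡ gap w B t
    gap-post {t} p≤t = cong₂ ℤ._-_ (height-post (sum-segment blk p) p≤t) (height∞-periodic blk t)

    v<gap-pre : {t : ℕ} → t < p → v ℤ.< gap (insert w B) B t
    v<gap-pre t<p = subst (v ℤ.<_) (sym (gap-pre (ℕ.<⇒≤ t<p))) (argmin-first (gap w B) (length w) t<p)

    v≤gap : {t : ℕ} → t ≤ length w + s → v ℤ.≤ gap (insert w B) B t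
    v≤gap {t} t≤n+s with t ℕ.<? p | t ℕ.≤? p + s
    ... | yes t<p | _ = ℤ.<⇒≤ (v<gap-pre t<p)
    ... | no t≮p | yes t≤p+s with k , refl ← ℕ.m≤n⇒∃[o]m+o≡n (ℕ.≮⇒≥ t≮p) =
      ℤ.≤-reflexive (sym (gap-mid (ℕ.+-cancelˡ-≤ p k s t≤p+s)))
    ... | no _ | no t≰p+s with t′ , p≤t′ , refl ← beyond (ℕ.<⇒≤ (ℕ.≰⇒> t≰p+s)) =
      subst (v ℤ.≤_) (sym (gap-post p≤t′))
        (argmin-minimal (gap w B) (length w) (ℕ.+-cancelʳ-≤ s t′ (length w) t≤n+s))

    ¬illegal-from-window : {k j : ℕ} → k < s → ¬ IllegalPair (insert w B) (p + k) j
    ¬illegal-from-window {k} {j} k<s (i<j , j<n , i%≡j% , hi≡hj , W!?i , W!?j)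
      with j′ , p≤j′ , refl ← beyond (ℕ.≤-trans (ℕ.+-monoˡ-≤ s (ℕ.m≤m+n p k)) (%≡∧<⇒+s≤ s i<j i%≡j%)) =
      ℤ.<⇒≱ gap-drops (argmin-minimal (gap w B) (length w) j′<n)
      where
      j′<n : j′ < length w
      j′<n = ℕ.+-cancelʳ-< s j′ (length w) (subst (_ <_) length-long j<n)
      letter-j′ : letter∞ B j′ ≡ plusA
      letter-j′ = trans (letter∞-mod-s B (sym (trans i%≡j% ([m+n]%n≡m%n j′ s))))
        (just-injective (trans (sym (!?-segment (letter∞ B) p k<s)) (trans (sym (!?-mid k<s)) W!?i)))
      gap-j′ : gap w B j′ ≡ v
      gap-j′ = trans (sym (gap-post p≤j′)) (trans (sym (gap-cong blk i%≡j% hi≡hj)) (gap-mid (ℕ.<⇒≤ k<s)))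
      gap-drops : gap w B (suc j′) ℤ.< v
      gap-drops = begin-strict
        gap w B (suc j′)
          ≡⟨ gap-suc w B j′ (trans (sym (!?-post p≤j′)) W!?j) ⟩
        gap w B j′ ℤ.+ (value minusB ℤ.- value (letter∞ B j′))
          ≡⟨ cong₂ (λ g l → g ℤ.+ (value minusB ℤ.- value l)) gap-j′ letter-j′ ⟩
        v ℤ.+ (value minusB ℤ.- value plusA)
          <⟨ ℤ.+-monoʳ-< v minus-plus<0 ⟩
        v ℤ.+ + 0
          ≡⟨ ℤ.+-identityʳ v ⟩
        v ∎
        where open ℤ.≤-Reasoning

    admissible-insert : Admissible w → Admissible (insert w B)
    admissible-insert adm {i} {j} illegal@(i<j , j<n , i%≡j% , hi≡hj , W!?i , W!?j)
      with j ℕ.<? p | i ℕ.<? p | i ℕ.<? p + s | j ℕ.<? p + s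
    ... | yes j<p | _ | _ | _ =
      adm (i<j , ℕ.<-≤-trans j<p p≤n , i%≡j% ,
           trans (sym (height-pre (ℕ.<⇒≤ (ℕ.<-trans i<j j<p)))) (trans hi≡hj (height-pre (ℕ.<⇒≤ j<p))) ,
           trans (sym (!?-pre (ℕ.<-trans i<j j<p))) W!?i , trans (sym (!?-pre j<p)) W!?j)
    ... | no j≮p | yes i<p | _ | yes j<p+s with k , refl ← ℕ.m≤n⇒∃[o]m+o≡n (ℕ.≮⇒≥ j≮p) =
      ℤ.<-irrefl (sym (trans (gap-cong blk i%≡j% hi≡hj) (gap-mid (ℕ.<⇒≤ (ℕ.+-cancelˡ-< p k s j<p+s)))))
                 (v<gap-pre i<p)
    ... | no j≮p | yes i<p | _ | no j≮p+s with j′ , p≤j′ , refl ← beyond (ℕ.≮⇒≥ j≮p+s) =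
      adm (ℕ.<-≤-trans i<p p≤j′ , ℕ.+-cancelʳ-< s j′ (length w) (subst (_ <_) length-long j<n) ,
           trans i%≡j% ([m+n]%n≡m%n j′ s) ,
           trans (sym (height-pre (ℕ.<⇒≤ i<p))) (trans hi≡hj (height-post (sum-segment blk p) p≤j′)) ,
           trans (sym (!?-pre i<p)) W!?i , trans (sym (!?-post p≤j′)) W!?j)
    ... | no _ | no i≮p | yes i<p+s | _ with k , refl ← ℕ.m≤n⇒∃[o]m+o≡n (ℕ.≮⇒≥ i≮p) =
      ¬illegal-from-window (ℕ.+-cancelˡ-< p k s i<p+s) illegal
    ... | no _ | no _ | no i≮p+s | _
      with i′ , p≤i′ , refl ← beyond (ℕ.≮⇒≥ i≮p+s)
         | j′ , p≤j′ , refl ← beyond (ℕ.≤-trans (ℕ.≮⇒≥ i≮p+s) (ℕ.<⇒≤ i<j)) =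
      adm (ℕ.+-cancelʳ-< s i′ j′ i<j , ℕ.+-cancelʳ-< s j′ (length w) (subst (_ <_) length-long j<n) ,
           trans (sym ([m+n]%n≡m%n i′ s)) (trans i%≡j% ([m+n]%n≡m%n j′ s)) ,
           trans (sym (height-post (sum-segment blk p) p≤i′)) (trans hi≡hj (height-post (sum-segment blk p) p≤j′)) ,
           trans (sym (!?-post p≤i′)) W!?i , trans (sym (!?-post p≤j′)) W!?j)

    sum-insert : sum (insert w B) ≡ sum w
    sum-insert = begin
      sum (insert w B)                     ≡⟨ sym (height-length (insert w B)) ⟩
      height (insert w B) (length (insert w B)) ≡⟨ cong (height (insert w B)) length-long ⟩
      height (insert w B) (length w + s)  ≡⟨ height-post (sum-segment blk p) p≤n ⟩
      height w (length w)                 ≡⟨ height-length w ⟩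
      sum w                               ∎
      where open ≡-Reasoning

    classMin-window : {k : ℕ} → k ≤ s → ClassMin (insert w B) (p + k)
    classMin-window {k} k≤s =
      subst (p + k ≤_) (sym length-long) (ℕ.+-mono-≤ p≤n k≤s) ,
      λ {u} u≤n u%≡ → +-cancelʳ-≤ _ _ (ℤ.- height∞ B u)
        (subst (ℤ._≤ gap (insert w B) B u) (trans (sym (gap-mid k≤s))
                 (cong (λ h → height (insert w B) (p + k) ℤ.- h) (height∞-mod-s blk (sym u%≡))))
               (v≤gap (subst (u ≤_) length-long u≤n)))

    classMin-p : ClassMin (insert w B) p
    classMin-p = subst (ClassMin (insert w B)) (ℕ.+-identityʳ p) (classMin-window z≤n)

    ¬classMin-before : {t : ℕ} → t < p → ¬ ClassMin (insert w B) t
    ¬classMin-before {t} t<p (_ , minimal) with residue-in-window s p t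
    ... | u , p≤u , u<p+s , u%≡t% with k , refl ← ℕ.m≤n⇒∃[o]m+o≡n p≤u =
      ℤ.<⇒≱ (+-cancelʳ-< _ _ (ℤ.- height∞ B t)
               (subst (ℤ._< gap (insert w B) B t)
                  (trans (sym (gap-mid k≤s))
                         (cong (λ h → height (insert w B) (p + k) ℤ.- h) (height∞-mod-s blk u%≡t%)))
                  (v<gap-pre t<p)))
            (minimal (proj₁ (classMin-window k≤s)) u%≡t%)
      where
      k≤s : k ≤ s
      k≤s = ℕ.<⇒≤ (ℕ.+-cancelˡ-< p k s u<p+s)

  segment-letter∞-injective : {B B′ : Word} → length B ≡ s → length B′ ≡ s → (p : ℕ) →
                              segment (letter∞ B) p s ≡ segment (letter∞ B′) p s → B ≡ B′
  segment-letter∞-injective {B} {B′} len≡ len′≡ p seg≡ =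
    !?-ext B B′ (trans len≡ (sym len′≡)) λ j j<n → at (subst (j <_) len≡ j<n)
    where
    at : {j : ℕ} → j < s → B !? j ≡ B′ !? j
    at {j} j<s with residue-in-window s p j
    ... | t , p≤t , t<p+s , t%≡j% with k , refl ← ℕ.m≤n⇒∃[o]m+o≡n p≤t = begin
      B !? j                                  ≡⟨ letter∞-< B len≡ j<s ⟩
      just (letter∞ B j)                      ≡⟨ cong just (letter∞-mod-s B (sym t%≡j%)) ⟩
      just (letter∞ B (p + k))                ≡⟨ sym (!?-segment (letter∞ B) p k<s) ⟩
      segment (letter∞ B) p s !? k            ≡⟨ cong (_!? k) seg≡ ⟩
      segment (letter∞ B′) p s !? k           ≡⟨ !?-segment (letter∞ B′) p k<s ⟩
      just (letter∞ B′ (p + k))               ≡⟨ cong just (letter∞-mod-s B′ t%≡j%) ⟩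
      just (letter∞ B′ j)                     ≡⟨ sym (letter∞-< B′ len′≡ j<s) ⟩
      B′ !? j                                 ∎
      where
      open ≡-Reasoning
      k<s : k < s
      k<s = ℕ.+-cancelˡ-< p k s t<p+s

  insertionPoint-unique : {w w′ B B′ : Word} → IsBlock B → IsBlock B′ → insert w B ≡ insert w′ B′ →
                          insertionPoint w B ≡ insertionPoint w′ B′
  insertionPoint-unique {w} {w′} {B} {B′} blk blk′ W≡W′ =
    ℕ.≤-antisym
      (ℕ.≮⇒≥ λ p′<p → I.¬classMin-before p′<p (subst (λ W → ClassMin W _) (sym W≡W′) I′.classMin-p))
      (ℕ.≮⇒≥ λ p<p′ → I′.¬classMin-before p<p′ (subst (λ W → ClassMin W _) W≡W′ I.classMin-p))
    where
    module I  = Insertion w B blk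
    module I′ = Insertion w′ B′ blk′

  insert-injective : {w w′ B B′ : Word} → IsBlock B → IsBlock B′ → insert w B ≡ insert w′ B′ →
                     w ≡ w′ × B ≡ B′
  insert-injective {w} {w′} {B} {B′} blk blk′ W≡W′ =
    let take≡ , rest≡ = ++-injective (take p w) _ (take p w′) _
                          (trans (length-take-≤ w (Insertion.p≤n w B blk)) (sym (length-take-≤ w′ p≤n′))) W≡W″
        seg≡ , drop≡  = ++-injective (segment (letter∞ B) p s) (drop p w) (segment (letter∞ B′) p s) (drop p w′)
                          (trans (length-segment _ p s) (sym (length-segment _ p s))) rest≡
    in
    trans (sym (List.take++drop≡id p w)) (trans (cong₂ _++_ take≡ drop≡) (List.take++drop≡id p w′)) ,
    segment-letter∞-injective (proj₁ blk) (proj₁ blk′) p seg≡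
    where
    p = insertionPoint w B
    p≡p′ : p ≡ insertionPoint w′ B′
    p≡p′ = insertionPoint-unique {w} {w′} {B} {B′} blk blk′ W≡W′
    p≤n′ : p ≤ length w′
    p≤n′ = subst (_≤ length w′) (sym p≡p′) (Insertion.p≤n w′ B′ blk′)
    W≡W″ : take p w ++ segment (letter∞ B) p s ++ drop p w ≡
           take p w′ ++ segment (letter∞ B′) p s ++ drop p w′
    W≡W″ = trans W≡W′ (cong (λ q → take q w′ ++ segment (letter∞ B′) q s ++ drop q w′) (sym p≡p′))

  +value-mono-≤ : (x y : Letter) {h h′ : ℤ} → h ℤ.≤ h′ →
                  (x ≡ plusA → y ≡ minusB → h′ ℤ.< h ℤ.+ + s → ⊥) →
                  h ℤ.+ value x ℤ.≤ h′ ℤ.+ value y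
  +value-mono-≤ plusA  plusA  h≤h′ _ = ℤ.+-monoˡ-≤ (+ a) h≤h′
  +value-mono-≤ minusB minusB h≤h′ _ = ℤ.+-monoˡ-≤ (ℤ.- + b) h≤h′
  +value-mono-≤ minusB plusA  h≤h′ _ = ℤ.+-mono-≤ h≤h′ ℤ.neg-≤-pos
  +value-mono-≤ plusA  minusB {h} {h′} h≤h′ not-close with h′ ℤ.<? h ℤ.+ + s
  ... | yes close = ⊥-elim (not-close refl refl close)
  ... | no  far   = subst (ℤ._≤ h′ ℤ.- + b) (regroup h (+ a) (+ b)) (ℤ.+-monoˡ-≤ (ℤ.- + b) (ℤ.≮⇒≥ far))
    where
    regroup : ∀ h a b → h ℤ.+ (a ℤ.+ b) ℤ.- b ≡ h ℤ.+ a
    regroup = solve-∀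

  module Deletion (W : Word) (n : ℕ) (lenW : length W ≡ s * suc n) (sumW≡0 : sum W ≡ + 0)
                  (adm : Admissible W) (p : ℕ) (classMin-p : ClassMin W p)
                  (¬classMin-before : ∀ {t} → t < p → ¬ ClassMin W t) where

    N : ℕ
    N = length W

    p≤classMin : {t : ℕ} → ClassMin W t → p ≤ t
    p≤classMin min-t = ℕ.≮⇒≥ (λ t<p → ¬classMin-before t<p min-t)

    FirstAtLevel : ℕ → Set
    FirstAtLevel t = ∀ {u} → u < t → u % s ≡ t % s → height W u ≡ height W t → ⊥

    N%s≡0 : N % s ≡ 0
    N%s≡0 = trans (cong (_% s) (trans lenW (ℕ.*-comm s (suc n)))) (m*n%n≡0 (suc n) s)

    s≤N : s ≤ N
    s≤N = subst (s ≤_) (sym lenW) (ℕ.m≤m*n s (suc n))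

    height-N : height W N ≡ height W 0
    height-N = trans (height-length W) sumW≡0

    classMin-suc : {t : ℕ} → t < N → ClassMin W t → FirstAtLevel t → ClassMin W (suc t)
    classMin-suc {t} t<N (_ , minimal) firstAtLevel = t<N , above
      where
      below-suc : ∀ {u} → u < N → suc u % s ≡ suc t % s → height W (suc t) ℤ.≤ height W (suc u)
      below-suc {u} u<N su%≡st% =
        subst₂ ℤ._≤_ (sym (height-suc W t (letterAt-< W t<N))) (sym (height-suc W u (letterAt-< W u<N)))
          (+value-mono-≤ (letterAt W t) (letterAt W u) (minimal (ℕ.<⇒≤ u<N) u%≡t%) not-close)
        where
        u%≡t% = suc-%-cancel s su%≡st%
        not-close : letterAt W t ≡ plusA → letterAt W u ≡ minusB → height W u ℤ.< height W t ℤ.+ + s → ⊥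
        not-close t-plus u-minus close
          with hu≡ht ← height-rigid-mod-s W (sym u%≡t%) (ℕ.<⇒≤ t<N) (ℕ.<⇒≤ u<N)
                                          (minimal (ℕ.<⇒≤ u<N) u%≡t%) close
          with ℕ.<-cmp t u
        ... | tri< t<u _ _ = adm (t<u , u<N , sym u%≡t% , sym hu≡ht ,
                                  trans (letterAt-< W t<N) (cong just t-plus) , trans (letterAt-< W u<N) (cong just u-minus))
        ... | tri≈ _ refl _ with () ← trans (sym t-plus) u-minus
        ... | tri> _ _ u<t = firstAtLevel u<t u%≡t% hu≡ht
      above : ∀ {u} → u ≤ N → u % s ≡ suc t % s → height W (suc t) ℤ.≤ height W u
      above {suc u} u<N su%≡ = below-suc u<N su%≡
      above {zero} _ 0%≡ =
        subst (height W (suc t) ℤ.≤_) (trans (cong (height W) N∸1+1≡N) height-N)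
          (below-suc (ℕ.≤-reflexive N∸1+1≡N)
            (trans (cong (_% s) N∸1+1≡N) (trans N%s≡0 (trans (sym (m<n⇒m%n≡m (ℕ.>-nonZero⁻¹ s))) 0%≡))))
        where
        N∸1+1≡N : suc (N ∸ 1) ≡ N
        N∸1+1≡N = ℕ.m+[n∸m]≡n (ℕ.<-≤-trans (ℕ.>-nonZero⁻¹ s) s≤N)

    firstAtLevel-window : {k : ℕ} → k < s → ClassMin W (p + k) → FirstAtLevel (p + k)
    firstAtLevel-window {k} k<s min-pk {u} u<pk u%≡ hu≡ =
      ℕ.<-irrefl (residue-unique-in-window s p≤u (ℕ.<-trans u<pk pk<p+s) (ℕ.m≤m+n p k) pk<p+s u%≡) u<pk
      where
      pk<p+s = ℕ.+-monoʳ-< p k<s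
      p≤u = p≤classMin (classMin-transfer min-pk (ℕ.≤-trans (ℕ.<⇒≤ u<pk) (proj₁ min-pk)) u%≡ hu≡)

    window-before-end : {k : ℕ} → k < s → ClassMin W (p + k) → p + k < N
    window-before-end {k} k<s min-pk with ℕ.m≤n⇒m<n∨m≡n (proj₁ min-pk)
    ... | inj₁ pk<N = pk<N
    ... | inj₂ pk≡N = ⊥-elim (ℕ.<⇒≱ k<s (subst (s ≤_) (trans (sym pk≡N) (cong (_+ k) p≡0)) s≤N))
      where
      0%≡N% : 0 % s ≡ (p + k) % s
      0%≡N% = trans (m<n⇒m%n≡m (ℕ.>-nonZero⁻¹ s)) (trans (sym N%s≡0) (cong (_% s) (sym pk≡N)))
      p≡0 : p ≡ 0
      p≡0 = ℕ.n≤0⇒n≡0 (p≤classMin (classMin-transfer min-pk z≤n 0%≡N%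
              (sym (trans (cong (height W) pk≡N) height-N))))

    classMin-window : {k : ℕ} → k ≤ s → ClassMin W (p + k)
    classMin-window {zero}  _   = subst (ClassMin W) (sym (ℕ.+-identityʳ p)) classMin-p
    classMin-window {suc k} k<s = subst (ClassMin W) (sym (ℕ.+-suc p k))
      (classMin-suc (window-before-end k<s min-pk) min-pk (firstAtLevel-window k<s min-pk))
      where
      min-pk = classMin-window (ℕ.<⇒≤ k<s)

    p+s≤N : p + s ≤ N
    p+s≤N = proj₁ (classMin-window ℕ.≤-refl)

    representative : ℕ → ℕ
    representative j = proj₁ (residue-in-window s p j)

    block : Word
    block = segment (λ j → letterAt W (representative j)) 0 s

    window : Word
    window = take s (drop p W)

    deleted : Word
    deleted = take p W ++ drop (p + s) W

    private
      rep-in-window : (j : ℕ) → ∃ λ k → representative j ≡ p + k × k < s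
      rep-in-window j with _ , p≤t , t<p+s , _ ← residue-in-window s p j
                      with k , refl ← ℕ.m≤n⇒∃[o]m+o≡n p≤t = k , refl , ℕ.+-cancelˡ-< p k s t<p+s

      rep-% : (j : ℕ) → representative j % s ≡ j % s
      rep-% j = proj₂ (proj₂ (proj₂ (residue-in-window s p j)))

      window≡ : take p W ++ window ++ drop (p + s) W ≡ W
      window≡ = begin
        take p W ++ take s (drop p W) ++ drop (p + s) W
          ≡⟨ cong (λ r → take p W ++ take s (drop p W) ++ r) (sym (List.drop-drop p s W)) ⟩
        take p W ++ take s (drop p W) ++ drop s (drop p W)
          ≡⟨ cong (take p W ++_) (List.take++drop≡id s (drop p W)) ⟩
        take p W ++ drop p W
          ≡⟨ List.take++drop≡id p W ⟩
        W ∎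
        where open ≡-Reasoning

    open Splice (take p W) window (drop (p + s) W) (length-take-≤ W (ℕ.≤-trans (ℕ.m≤m+n p s) p+s≤N))
                (length-take-drop W {p} {s} p+s≤N) {W} {deleted} window≡ refl public

    letter∞-block : {k : ℕ} → k < s → letter∞ block (p + k) ≡ letterAt W (p + k)
    letter∞-block {k} k<s = begin
      letterAt block ((p + k) % s)                  ≡⟨ cong (fromMaybe plusA) (!?-segment _ 0 (m%n<n (p + k) s)) ⟩
      letterAt W (representative ((p + k) % s))    ≡⟨ cong (letterAt W) rep≡ ⟩
      letterAt W (p + k)                            ∎
      where
      open ≡-Reasoning
      rep≡ : representative ((p + k) % s) ≡ p + k
      rep≡ with k′ , r≡ , k′<s ← rep-in-window ((p + k) % s) = residue-unique-in-window s
        (subst (p ≤_) (sym r≡) (ℕ.m≤m+n p k′)) (subst (_< p + s) (sym r≡) (ℕ.+-monoʳ-< p k′<s))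
        (ℕ.m≤m+n p k) (ℕ.+-monoʳ-< p k<s) (trans (rep-% _) (m%n%n≡m%n (p + k) s))

    segment-block : segment (letter∞ block) p s ≡ window
    segment-block = !?-ext _ _ (trans (length-segment _ p s) (sym (length-take-drop W {p} {s} p+s≤N))) λ k k<|seg| →
      let k<s = subst (k <_) (length-segment _ p s) k<|seg| in begin
      segment (letter∞ block) p s !? k   ≡⟨ !?-segment _ p k<s ⟩
      just (letter∞ block (p + k))       ≡⟨ cong just (letter∞-block k<s) ⟩
      just (letterAt W (p + k))          ≡⟨ sym (letterAt-< W (ℕ.<-≤-trans (ℕ.+-monoʳ-< p k<s) p+s≤N)) ⟩
      W !? (p + k)                       ≡⟨ !?-mid k<s ⟩
      window !? k                        ∎
      where open ≡-Reasoning

    height-p+s : height W (p + s) ≡ height W p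
    height-p+s = ℤ.≤-antisym (proj₂ (classMin-window ℕ.≤-refl) (proj₁ classMin-p) (sym ([m+n]%n≡m%n p s)))
                             (proj₂ classMin-p p+s≤N ([m+n]%n≡m%n p s))

    height-window : {k : ℕ} → k ≤ s → height W (p + k) ≡ height W p ℤ.+ height window k
    height-window {k} k≤s = trans (height-mid k≤s) (cong (ℤ._+ height window k) (sym (height-pre {p} ℕ.≤-refl)))

    sum-window : sum window ≡ + 0
    sum-window = begin
      sum window
        ≡⟨ sym (height-length window) ⟩
      height window (length window)
        ≡⟨ cong (height window) (length-take-drop W {p} {s} p+s≤N) ⟩
      height window s
        ≡⟨ identityʳ-unique (height W p) _ (trans (sym (height-window ℕ.≤-refl)) height-p+s) ⟩
      + 0 ∎
      where
      open ≡-Reasoning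

    isBlock : IsBlock block
    isBlock = length-segment _ 0 s , (begin
      sum block
        ≡⟨ sym (height-length block) ⟩
      height block (length block)
        ≡⟨ cong (height block) (length-segment _ 0 s) ⟩
      height block s
        ≡⟨ sym (height∞-≤s block (length-segment _ 0 s) ℕ.≤-refl) ⟩
      height∞ block s
        ≡⟨ identityʳ-unique (height∞ block p) _ (trans (sym (height∞-+s block p)) (sym period)) ⟩
      + 0 ∎)
      where
      open ≡-Reasoning
      period : height∞ block p ≡ height∞ block (p + s)
      period = sym (ℤ.i-j≡0⇒i≡j _ _ (begin
        height∞ block (p + s) ℤ.- height∞ block p  ≡⟨ sym (height-segment block p ℕ.≤-refl) ⟩
        height (segment (letter∞ block) p s) s     ≡⟨ cong (λ Y → height Y s) segment-block ⟩
        height window s                            ≡⟨ cong (height window) (sym (length-take-drop W {p} {s} p+s≤N)) ⟩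
        height window (length window)              ≡⟨ height-length window ⟩
        sum window                                 ≡⟨ sum-window ⟩
        + 0                                        ∎))

    v : ℤ
    v = gap W block p

    gap-window : {k : ℕ} → k ≤ s → gap W block (p + k) ≡ v
    gap-window {k} k≤s = gap-along-segment {W} {block} {p} {k} {height W p} k≤s
      (trans (height-window k≤s) (cong (λ Y → height W p ℤ.+ height Y k) (sym segment-block)))

    private
      window-witness : (t : ℕ) → ∃ λ u → ClassMin W u × gap W block u ≡ v × u % s ≡ t % s
      window-witness t with k , u≡ , k<s ← rep-in-window t =
        p + k , classMin-window (ℕ.<⇒≤ k<s) , gap-window (ℕ.<⇒≤ k<s) , subst (λ u → u % s ≡ t % s) u≡ (rep-% t)

      gap-mod-s : {u t : ℕ} → u % s ≡ t % s → gap W block u ≡ height W u ℤ.- height∞ block t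
      gap-mod-s {u} u%≡t% = cong (λ H → height W u ℤ.- H) (height∞-mod-s isBlock u%≡t%)

    v≤gap : {t : ℕ} → t ≤ N → v ℤ.≤ gap W block t
    v≤gap {t} t≤N = let u , (_ , minimal) , gap-u , u%≡t% = window-witness t in
      subst (ℤ._≤ gap W block t) (trans (sym (gap-mod-s u%≡t%)) gap-u)
        (ℤ.+-monoˡ-≤ (ℤ.- height∞ block t) (minimal t≤N (sym u%≡t%)))


    v<gap-before : {t : ℕ} → t < p → v ℤ.< gap W block t
    v<gap-before {t} t<p = let u , min-u , gap-u , u%≡t% = window-witness t in
      ℤ.≤∧≢⇒< (v≤gap t≤N) λ v≡gap-t →
        ¬classMin-before t<p (classMin-transfer min-u t≤N (sym u%≡t%)
          (∙-cancelʳ (ℤ.- height∞ block t) (height W t) (height W u)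
            (trans (sym v≡gap-t) (trans (sym gap-u) (gap-mod-s u%≡t%)))))
      where
      t≤N : t ≤ N
      t≤N = ℕ.≤-trans (ℕ.<⇒≤ t<p) (proj₁ classMin-p)

    p≤|deleted| : p ≤ length deleted
    p≤|deleted| = ℕ.+-cancelʳ-≤ s p (length deleted) (subst (p + s ≤_) length-long p+s≤N)

    gap-deleted-pre : {t : ℕ} → t ≤ p → gap deleted block t ≡ gap W block t
    gap-deleted-pre {t} t≤p = cong (ℤ._- height∞ block t) (sym (height-pre t≤p))

    gap-deleted-post : {t : ℕ} → p ≤ t → gap deleted block t ≡ gap W block (t + s)
    gap-deleted-post {t} p≤t = cong₂ ℤ._-_ (sym (height-post sum-window p≤t)) (sym (height∞-periodic isBlock t))

    insertionPoint-deleted : insertionPoint deleted block ≡ p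
    insertionPoint-deleted = argmin-unique (gap deleted block) (length deleted) p≤|deleted| minimal first
      where
      gap-p : gap deleted block p ≡ v
      gap-p = gap-deleted-pre ℕ.≤-refl
      minimal : ∀ {t} → t ≤ length deleted → gap deleted block p ℤ.≤ gap deleted block t
      minimal {t} t≤n with t ℕ.<? p
      ... | yes t<p = subst₂ ℤ._≤_ (sym gap-p) (sym (gap-deleted-pre (ℕ.<⇒≤ t<p))) (ℤ.<⇒≤ (v<gap-before t<p))
      ... | no  t≮p = subst₂ ℤ._≤_ (sym gap-p) (sym (gap-deleted-post (ℕ.≮⇒≥ t≮p)))
                        (v≤gap (subst (t + s ≤_) (sym length-long) (ℕ.+-monoˡ-≤ s t≤n)))
      first : ∀ {t} → t < p → gap deleted block p ℤ.< gap deleted block t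
      first t<p = subst₂ ℤ._<_ (sym gap-p) (sym (gap-deleted-pre (ℕ.<⇒≤ t<p))) (v<gap-before t<p)

    insert-deleted : insert deleted block ≡ W
    insert-deleted = begin
      insert deleted block
        ≡⟨ cong (λ q → take q deleted ++ segment (letter∞ block) q s ++ drop q deleted) insertionPoint-deleted ⟩
      take p deleted ++ segment (letter∞ block) p s ++ drop p deleted
        ≡⟨ cong₂ (λ X Z → X ++ segment (letter∞ block) p s ++ Z) take≡ drop≡ ⟩
      take p W ++ segment (letter∞ block) p s ++ drop (p + s) W
        ≡⟨ cong (λ Y → take p W ++ Y ++ drop (p + s) W) segment-block ⟩
      take p W ++ window ++ drop (p + s) W
        ≡⟨ window≡ ⟩
      W ∎
      where
      open ≡-Reasoning
      |X| : length (take p W) ≡ p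
      |X| = length-take-≤ W (proj₁ classMin-p)
      take≡ : take p deleted ≡ take p W
      take≡ = trans (take-++ˡ (take p W) _ (ℕ.≤-reflexive (sym |X|))) (take-take-≤ W ℕ.≤-refl)
      drop≡ : drop p deleted ≡ drop (p + s) W
      drop≡ = trans (cong (λ q → drop q deleted) (sym |X|)) (drop-length-++ (take p W) _)

    length-deleted : length deleted ≡ s * n
    length-deleted = ℕ.+-cancelʳ-≡ s (length deleted) (s * n)
      (trans (sym length-long) (trans lenW (trans (ℕ.*-suc s n) (ℕ.+-comm s (s * n)))))

    sum-deleted : sum deleted ≡ + 0
    sum-deleted = begin
      sum deleted                              ≡⟨ sym (height-length deleted) ⟩
      height deleted (length deleted)          ≡⟨ sym (height-post sum-window p≤|deleted|) ⟩
      height W (length deleted + s)            ≡⟨ cong (height W) (sym length-long) ⟩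
      height W N                               ≡⟨ height-N ⟩
      + 0                                      ∎
      where open ≡-Reasoning

    admissible-deleted : Admissible deleted
    admissible-deleted = admissible-short sum-window adm

  sum≡0⇒#minus≡a : {x : Word} → length x ≡ s → sum x ≡ + 0 → #minus x ≡ a
  sum≡0⇒#minus≡a {x} len≡ sum≡0 = ℕ.*-cancelˡ-≡ (#minus x) a s (begin
    (a + b) * M          ≡⟨ ℕ.*-distribʳ-+ M a b ⟩
    a * M + b * M        ≡⟨ cong (λ r → a * M + r) (sym aP≡bM) ⟩
    a * M + a * P        ≡⟨ sym (ℕ.*-distribˡ-+ a M P) ⟩
    a * (M + P)          ≡⟨ cong (a *_) (trans (ℕ.+-comm M P) (trans (#plus+#minus x) len≡)) ⟩
    a * s                ≡⟨ ℕ.*-comm a s ⟩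
    s * a                ∎)
    where
    open ≡-Reasoning
    P = #plus x
    M = #minus x
    aP≡bM : a * P ≡ b * M
    aP≡bM = ℤ.+-injective (begin
      + (a * P)            ≡⟨ ℤ.pos-* a P ⟩
      + a ℤ.* + P          ≡⟨ ℤ.i-j≡0⇒i≡j _ _ (trans (sym (sum-#plus-#minus x)) sum≡0) ⟩
      + b ℤ.* + M          ≡⟨ sym (ℤ.pos-* b M) ⟩
      + (b * M)            ∎)

  #minus≡a⇒sum≡0 : {x : Word} → length x ≡ s → #minus x ≡ a → sum x ≡ + 0
  #minus≡a⇒sum≡0 {x} len≡ #minus≡a = begin
    sum x                                      ≡⟨ sum-#plus-#minus x ⟩
    + a ℤ.* + #plus x ℤ.- + b ℤ.* + #minus x   ≡⟨ cong₂ (λ P M → + a ℤ.* + P ℤ.- + b ℤ.* + M) #plus≡b #minus≡a ⟩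
    + a ℤ.* + b ℤ.- + b ℤ.* + a                ≡⟨ cancel (+ a) (+ b) ⟩
    + 0                                        ∎
    where
    open ≡-Reasoning
    #plus≡b : #plus x ≡ b
    #plus≡b = ℕ.+-cancelʳ-≡ (#minus x) (#plus x) b
      (trans (#plus+#minus x) (trans len≡ (trans (ℕ.+-comm a b) (cong (λ r → b + r) (sym #minus≡a)))))
    cancel : ∀ A B → A ℤ.* B ℤ.- B ℤ.* A ≡ + 0
    cancel = solve-∀

  count-blocks : HasCount IsBlock (s C a)
  count-blocks =
    wordsWith s a , wordsWith-unique s a ,
    All.tabulate (λ {B} B∈ → let len≡ , #≡ = ∈-wordsWith⁻ s a B∈ in len≡ , #minus≡a⇒sum≡0 {B} len≡ #≡) ,
    (λ B (len≡ , sum≡0) →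
       subst₂ (λ m k → B ∈ wordsWith m k) len≡ (sum≡0⇒#minus≡a {B} len≡ sum≡0) (∈-wordsWith⁺ B)) ,
    length-wordsWith s a

  count-empty : HasCount (Counted a b (s * 0)) 1
  count-empty = [ [] ] , [] ∷ [] , (sym (ℕ.*-zeroʳ s) , refl , λ { _ _ _ (_ , () , _) }) ∷ [] , complete , refl
    where
    complete : ∀ w → Counted a b (s * 0) w → w ∈ [ [] ]
    complete []      _           = here refl
    complete (_ ∷ _) (len≡ , _) with () ← trans len≡ (ℕ.*-zeroʳ s)

  count-insert : (n : ℕ) {M : ℕ} → HasCount (Counted a b (s * n)) M →
                 HasCount (Counted a b (s * suc n)) (M * (s C a))
  count-insert n counted = hasCount-image counted count-blocks insert counted-insert
    (λ _ blk _ blk′ → insert-injective blk blk′) deletion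
    where
    counted-insert : ∀ {w B} → Counted a b (s * n) w → IsBlock B → Counted a b (s * suc n) (insert w B)
    counted-insert {w} {B} (len≡ , sum≡0 , noBad) blk =
      trans I.length-long (trans (cong (_+ s) len≡) (trans (ℕ.+-comm (s * n) s) (sym (ℕ.*-suc s n)))) ,
      trans I.sum-insert sum≡0 ,
      admissible⇒noBadIllegal (insert w B) (I.admissible-insert (noBadIllegal⇒admissible w noBad))
      where module I = Insertion w B blk
    deletion : ∀ {W} → Counted a b (s * suc n) W →
               ∃ λ w → ∃ λ B → Counted a b (s * n) w × IsBlock B × insert w B ≡ W
    deletion {W} (len≡ , sum≡0 , noBad) =
      D.deleted , D.block ,
      (D.length-deleted , D.sum-deleted , admissible⇒noBadIllegal D.deleted D.admissible-deleted) ,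
      D.isBlock , D.insert-deleted
      where
      first = first-classMin W
      module D = Deletion W n len≡ sum≡0 (noBadIllegal⇒admissible W noBad)
                          (proj₁ first) (proj₁ (proj₂ first)) (proj₂ (proj₂ first))

  count : (n : ℕ) → HasCount (Counted a b (s * n)) ((s C a) ^ n)
  count zero    = count-empty
  count (suc n) =
    subst (HasCount (Counted a b (s * suc n))) (ℕ.*-comm ((s C a) ^ n) (s C a)) (count-insert n (count n))

theorem3 : (a b n : ℕ) →
    HasCount (Counted (suc a) (suc b) ((suc a + suc b) * n))
             (((suc a + suc b) C suc a) ^ n)
theorem3 a b = ZeroSumWords.count (suc a) (suc b)
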